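{- For any ideal $\mathcal{I}$ on $\omega$, if $\mathcal{I}$ is a $\sigma$-porous subset of $2^\omega$, then $\mathcal{I}\subseteq \mathit{Thick}^+$.
   Context: $\omega=\{0,1,2,\dots\}$; subsets of $\omega$ are identified with elements of $2^\omega$. An ideal is a nonempty family $\mathcal{I}$ of subsets of $\omega$ closed under subsets and finite unions (assumed proper, i.e. $\omega\notin\mathcal{I}$). A set $T\subseteq\omega$ is thick if for every $p$ there is $n$ with $\{n,\dots,n+p\}\subseteq T$; $\mathit{Thick}^+$ is the family of subsets of $\omega$ that are not thick. $2^\omega$ carries the metric $\rho(s,t)=2^{ -\min\{i: s(i)\neq t(i)\}}$ for $s\ne t$, $\rho(s,s)=0$. A set $E\subseteq 2^\omega$ is porous if there exist $0<\alpha<1$, $\varepsilon_0>0$ such that for every $0<\varepsilon\le\varepsilon_0$ and $x\in2^\omega$ there is $y$ with $B(y,\alpha\varepsilon)\subseteq B(x,\varepsilon)\setminus E$. $\sigma$-porous means a countable union of porous sets.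
   Formalization: The porosity parameters $\alpha$, $\varepsilon_0$ and the radii $\varepsilon$ range over the rationals. -}

module Defs where

open import Data.Nat using (ℕ; zero; suc; _+_) renaming (_≤_ to _≤ℕ_)
open import Data.Bool using (Bool; true; false; _∨_)
open import Data.Rational using (ℚ; 0ℚ; 1ℚ; ½; _*_; _<_; _≤_)
open import Data.Product using (Σ; _×_; ∃)
open import Data.Empty using (⊥)
open import Relation.Nullary using (¬_)
open import Relation.Binary.PropositionalEquality using (_≡_)

-- Cantor space 2^ω; a point is also (the characteristic function of) a subset of ω
Cantor : Set
Cantor = ℕ → Bool

Family : Set₁
Family = Cantor → Set

half^ : ℕ → ℚ
half^ zero    = 1ℚ
half^ (suc i) = ½ * half^ i

-- y ∈ B(x, ε), i.e. ρ(x,y) < ε, where ρ(s,t) = 2^{-min{i : s(i) ≠ t(i)}}, ρ(s,s)=0.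
-- Unfolded: ρ(x,y) < ε iff every index i with 2^{-i} ≥ ε is an index of agreement.
InBall : Cantor → ℚ → Cantor → Set
InBall x ε y = ∀ i → ε ≤ half^ i → x i ≡ y i

_⊆ω_ : Cantor → Cantor → Set
A ⊆ω B = ∀ n → A n ≡ true → B n ≡ true

record IsIdeal (I : Family) : Set₁ where
  field
    nonempty  : ∃ λ A → I A
    downward  : ∀ A B → A ⊆ω B → I B → I A
    union     : ∀ A B → I A → I B → I (λ n → A n ∨ B n)
    proper    : ¬ I (λ _ → true)

Porous : Family → Set
Porous E =
  Σ ℚ λ α → (0ℚ < α) × (α < 1ℚ) ×
  Σ ℚ λ ε₀ → (0ℚ < ε₀) ×
  (∀ ε → 0ℚ < ε → ε ≤ ε₀ → ∀ x →
     Σ Cantor λ y → ∀ z → InBall y (α * ε) z → InBall x ε z × ¬ E z)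

SigmaPorous : Family → Set₁
SigmaPorous F =
  Σ (ℕ → Family) λ E → (∀ n → Porous (E n)) × (∀ x → F x → Σ ℕ λ n → E n x)

Thick : Cantor → Set
Thick T = ∀ p → Σ ℕ λ n → ∀ k → k ≤ℕ p → T (n + k) ≡ true

ThickPlus : Family
ThickPlus T = ¬ Thick T

{-# OPTIONS --safe #-}
module Submission where

-- A porous set has holes of bounded relative depth: there are c and d such that for every
-- m ≥ d, every cylinder of length m contains a cylinder of length m + c disjoint from it.
-- A thick set A contains an interval of length c beyond any given level, so given porous
-- sets E j, a subset of A can be steered into a hole of each E j in turn, leaving free only
-- c coordinates inside such an interval.  The limit x of these stages is a subset of A
-- outside every E j; an ideal containing A contains x, hence is not covered by the E j.

open import Defs

open import Data.Bool using (true; false; _∧_)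
open import Data.Integer as ℤ using (+_; +[1+_]; -[1+_])
open import Data.Nat as ℕ using (ℕ; zero; suc; _+_; _∸_; _≤_; _<_; _≤′_; z≤n; s≤s)
import Data.Nat.Properties as ℕ
open import Data.Product using (Σ; ∃; _×_; _,_; proj₁; proj₂)
open import Data.Rational as ℚ using (mkℚ; 0ℚ; 1ℚ; ½; _*_; Positive)
import Data.Rational.Properties as ℚ
open import Data.Rational.Unnormalised as ℚᵘ using (ℚᵘ; mkℚᵘ)
import Data.Rational.Unnormalised.Properties as ℚᵘ
open import Data.Sum using (inj₁; inj₂)
open import Function using (_∘_)
open import Relation.Binary.PropositionalEquality
open import Relation.Nullary using (¬_; yes; no)

half^-positive : ∀ k → Positive (half^ k)
half^-positive zero    = _
half^-positive (suc k) = ℚ.pos*pos⇒pos ½ (half^ k) {{half^-positive k}}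

half^>0 : ∀ k → 0ℚ ℚ.< half^ k
half^>0 k = ℚ.positive⁻¹ (half^ k) {{half^-positive k}}

half^-suc-≤ : ∀ k → half^ (suc k) ℚ.≤ half^ k
half^-suc-≤ k = begin
  ½ * half^ k   ≤⟨ ℚ.*-monoʳ-≤-nonNeg (half^ k) {{half^-nonNeg}} {½} {1ℚ} (ℚ.*≤* (ℤ.+≤+ (s≤s z≤n))) ⟩
  1ℚ * half^ k  ≡⟨ ℚ.*-identityˡ (half^ k) ⟩
  half^ k       ∎
  where
  open ℚ.≤-Reasoning
  half^-nonNeg = ℚ.pos⇒nonNeg (half^ k) {{half^-positive k}}

half^-antimono-≤′ : ∀ {i j} → i ≤′ j → half^ j ℚ.≤ half^ i
half^-antimono-≤′ ℕ.≤′-refl            = ℚ.≤-refl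
half^-antimono-≤′ (ℕ.≤′-step {j} i≤j) = ℚ.≤-trans (half^-suc-≤ j) (half^-antimono-≤′ i≤j)

half^-antimono-≤ : ∀ {i j} → i ≤ j → half^ j ℚ.≤ half^ i
half^-antimono-≤ = half^-antimono-≤′ ∘ ℕ.≤⇒≤′

half^-homo-+ : ∀ a b → half^ (a + b) ≡ half^ a * half^ b
half^-homo-+ zero    b = sym (ℚ.*-identityˡ (half^ b))
half^-homo-+ (suc a) b = begin
  ½ * half^ (a + b)        ≡⟨ cong (½ *_) (half^-homo-+ a b) ⟩
  ½ * (half^ a * half^ b)  ≡⟨ ℚ.*-assoc ½ (half^ a) (half^ b) ⟨
  ½ * half^ a * half^ b    ∎
  where open ≡-Reasoning

-- Multiplication in ℚ normalises by a gcd, so the closed form of ½^k is computed in ℚᵘ.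
half^ᵘ : ℕ → ℚᵘ
half^ᵘ zero    = ℚᵘ.1ℚᵘ
half^ᵘ (suc k) = ℚᵘ.½ ℚᵘ.* half^ᵘ k

toℚᵘ-half^ : ∀ k → ℚ.toℚᵘ (half^ k) ℚᵘ.≃ half^ᵘ k
toℚᵘ-half^ zero    = ℚᵘ.≃-refl
toℚᵘ-half^ (suc k) = ℚᵘ.≃-trans (ℚ.toℚᵘ-homo-* ½ (half^ k)) (ℚᵘ.*-congˡ {ℚᵘ.½} (toℚᵘ-half^ k))

half^ᵘ-unitFraction : ∀ k → ∃ λ D → half^ᵘ k ≡ mkℚᵘ (+ 1) D × k ≤ D
half^ᵘ-unitFraction zero = 0 , refl , z≤n
half^ᵘ-unitFraction (suc k) with half^ᵘ-unitFraction k
... | D , eq , k≤D rewrite eq =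
  _ , refl , ℕ.≤-trans (s≤s k≤D) (ℕ.≤-trans (ℕ.m≤n*m (suc D) 1) (ℕ.m≤n+m _ D))

half^-archimedean : ∀ q → 0ℚ ℚ.< q → ∃ λ k → half^ k ℚ.< q
half^-archimedean (mkℚ +[1+ n ] d-1 _) _ =
  suc d-1 , ℚ.toℚᵘ-cancel-< (ℚᵘ.<-respˡ-≃ (ℚᵘ.≃-sym (toℚᵘ-half^ (suc d-1))) half^ᵘ<q)
  where
  half^ᵘ<q : half^ᵘ (suc d-1) ℚᵘ.< mkℚᵘ +[1+ n ] d-1
  half^ᵘ<q with half^ᵘ-unitFraction (suc d-1)
  ... | D , eq , 1+d-1≤D rewrite eq =
    ℚᵘ.*<* (ℤ.+<+ (s≤s (ℕ.≤-trans (ℕ.≤-reflexive (cong suc (ℕ.+-identityʳ d-1)))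
                                   (ℕ.≤-trans 1+d-1≤D (ℕ.m≤m+n D _)))))
half^-archimedean (mkℚ (+ zero) _ _) (ℚ.*<* (ℤ.+<+ ()))
half^-archimedean (mkℚ -[1+ _ ] _ _) (ℚ.*<* ())

half^-+<*half^ : ∀ {α} m c → half^ c ℚ.< α → half^ (m + c) ℚ.< α * half^ m
half^-+<*half^ {α} m c half^c<α = begin-strict
  half^ (m + c)      ≡⟨ half^-homo-+ m c ⟩
  half^ m * half^ c  <⟨ ℚ.*-monoʳ-<-pos (half^ m) {{half^-positive m}} half^c<α ⟩
  half^ m * α        ≡⟨ ℚ.*-comm (half^ m) α ⟩
  α * half^ m        ∎
  where open ℚ.≤-Reasoning

infix 4 _≈[_]_
_≈[_]_ : Cantor → ℕ → Cantor → Set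
x ≈[ n ] y = ∀ i → i < n → x i ≡ y i

≈-sym : ∀ {x y n} → x ≈[ n ] y → y ≈[ n ] x
≈-sym x≈y i i<n = sym (x≈y i i<n)

≈-trans : ∀ {x y z n} → x ≈[ n ] y → y ≈[ n ] z → x ≈[ n ] z
≈-trans x≈y y≈z i i<n = trans (x≈y i i<n) (y≈z i i<n)

≈-weaken : ∀ {x y m n} → m ≤ n → x ≈[ n ] y → x ≈[ m ] y
≈-weaken m≤n x≈y i i<m = x≈y i (ℕ.<-≤-trans i<m m≤n)

infixr 6 _∩_
_∩_ : Cantor → Cantor → Cantor
(x ∩ y) i = x i ∧ y i

∩-⊆ʳ : ∀ x y → (x ∩ y) ⊆ω y
∩-⊆ʳ x y i with x i
... | true  = λ yᵢ → yᵢ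
... | false = λ ()

∩-≈ˡ : ∀ {x y n} → (∀ i → i < n → x i ≡ true → y i ≡ true) → x ∩ y ≈[ n ] x
∩-≈ˡ {x} {y} x⊆y i i<n with x i | x⊆y i i<n
... | true  | xᵢ⇒yᵢ = xᵢ⇒yᵢ refl
... | false | _     = refl

InBall-half^⇒≈ : ∀ {x y m} → InBall x (half^ m) y → x ≈[ m ] y
InBall-half^⇒≈ y∈B i i<m = y∈B i (half^-antimono-≤ (ℕ.<⇒≤ i<m))

≈⇒InBall : ∀ {α y z} m c → half^ c ℚ.< α → y ≈[ m + c ] z → InBall y (α * half^ m) z
≈⇒InBall {α} m c half^c<α y≈z i αε≤half^i = y≈z i (ℕ.≰⇒> m+c≰i)
  where
  m+c≰i : ¬ m + c ≤ i
  m+c≰i m+c≤i = ℚ.<-irrefl refl (begin-strict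
    half^ i        ≤⟨ half^-antimono-≤ m+c≤i ⟩
    half^ (m + c)  <⟨ half^-+<*half^ m c half^c<α ⟩
    α * half^ m    ≤⟨ αε≤half^i ⟩
    half^ i        ∎)
    where open ℚ.≤-Reasoning

record PrefixPorous (E : Family) : Set where
  field
    depth threshold : ℕ
    hole : ∀ m → threshold ≤ m → ∀ x →
           Σ Cantor λ y → x ≈[ m ] y × (∀ z → y ≈[ m + depth ] z → ¬ E z)

porous⇒prefixPorous : ∀ {E} → Porous E → PrefixPorous E
porous⇒prefixPorous {E} (α , α>0 , _ , ε₀ , ε₀>0 , porous)
  with half^-archimedean α α>0 | half^-archimedean ε₀ ε₀>0
... | c , half^c<α | d , half^d<ε₀ = record { depth = c ; threshold = d ; hole = hole }
  where
  hole : ∀ m → d ≤ m → ∀ x → Σ Cantor λ y → x ≈[ m ] y × (∀ z → y ≈[ m + c ] z → ¬ E z)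
  hole m d≤m x =
    let ε≤ε₀ = ℚ.≤-trans (half^-antimono-≤ d≤m) (ℚ.<⇒≤ half^d<ε₀)
        y , B[y]⊆B[x]∖E = porous (half^ m) (half^>0 m) ε≤ε₀ x
    in y , InBall-half^⇒≈ (proj₁ (B[y]⊆B[x]∖E y (λ _ _ → refl)))
         , λ z y≈z → proj₂ (B[y]⊆B[x]∖E z (≈⇒InBall m c half^c<α y≈z))

Thick⇒block-beyond : ∀ {A} → Thick A → ∀ b p →
                     ∃ λ m → b ≤ m × (∀ i → m ≤ i → i < m + p → A i ≡ true)
Thick⇒block-beyond {A} thick b p with thick (b + p)
... | n , block = n + b , ℕ.m≤n+m b n , A-on-block
  where
  A-on-block : ∀ i → n + b ≤ i → i < n + b + p → A i ≡ true
  A-on-block i n+b≤i i<n+b+p =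
    subst (λ k → A k ≡ true) (ℕ.m+[n∸m]≡n n≤i) (block (i ∸ n) (ℕ.m≤n+o⇒m∸n≤o i n i≤n+[b+p]))
    where
    n≤i : n ≤ i
    n≤i = ℕ.≤-trans (ℕ.m≤m+n n b) n+b≤i
    i≤n+[b+p] : i ≤ n + (b + p)
    i≤n+[b+p] = ℕ.≤-trans (ℕ.<⇒≤ i<n+b+p) (ℕ.≤-reflexive (ℕ.+-assoc n b p))

record Stage (A : Cantor) : Set where
  field
    length : ℕ
    point  : Cantor
    point⊆A : point ⊆ω A
open Stage

record Extension {A : Cantor} (E : Family) (t : Stage A) : Set where
  field
    next    : Stage A
    longer  : length t < length next
    extends : point next ≈[ length t ] point t
    avoids  : ∀ z → point next ≈[ length next ] z → ¬ E z

extend-into-hole : ∀ {A E} → PrefixPorous E → Thick A → (t : Stage A) → Extension E t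
extend-into-hole {A} record { depth = c ; threshold = d ; hole = hole } A-thick t
  with Thick⇒block-beyond A-thick (suc (length t + d)) c
... | m , L+d<m , A-on-block
  with hole m (ℕ.≤-trans (ℕ.m≤n+m d (length t)) (ℕ.<⇒≤ L+d<m)) (point t)
... | y , t≈y , y-hole = record
  { next    = record { length = m + c ; point = y ∩ A ; point⊆A = ∩-⊆ʳ y A }
  ; longer  = L<m+c
  ; extends = λ i i<L → trans (y∩A≈y i (ℕ.<-trans i<L L<m+c)) (sym (t≈y i (ℕ.<-trans i<L L<m)))
  ; avoids  = λ z y∩A≈z → y-hole z (≈-trans (≈-sym y∩A≈y) y∩A≈z)
  }
  where
  L<m : length t < m
  L<m = ℕ.≤-<-trans (ℕ.m≤m+n (length t) d) L+d<m
  L<m+c : length t < m + c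
  L<m+c = ℕ.<-≤-trans L<m (ℕ.m≤m+n m c)
  y⊆A : ∀ i → i < m + c → y i ≡ true → A i ≡ true
  y⊆A i i<m+c with i ℕ.<? m
  ... | yes i<m = λ yᵢ → point⊆A t i (trans (t≈y i i<m) yᵢ)
  ... | no  i≮m = λ _ → A-on-block i (ℕ.≮⇒≥ i≮m) i<m+c
  y∩A≈y : y ∩ A ≈[ m + c ] y
  y∩A≈y = ∩-≈ˡ y⊆A

module Fusion (s : ℕ → Cantor) (L : ℕ → ℕ)
              (coherent : ∀ k → s (suc k) ≈[ L k ] s k)
              (growing : ∀ k → L k < L (suc k)) where

  limit : Cantor
  limit i = s (suc i) i

  L-mono : ∀ {k k′} → k ≤′ k′ → L k ≤ L k′
  L-mono ℕ.≤′-refl              = ℕ.≤-refl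
  L-mono (ℕ.≤′-step {k′} k≤k′) = ℕ.≤-trans (L-mono k≤k′) (ℕ.<⇒≤ (growing k′))

  coherent* : ∀ {k k′} → k ≤′ k′ → s k′ ≈[ L k ] s k
  coherent* ℕ.≤′-refl              = λ _ _ → refl
  coherent* (ℕ.≤′-step {k′} k≤k′) = ≈-trans (≈-weaken (L-mono k≤k′) (coherent k′)) (coherent* k≤k′)

  k≤L : ∀ k → k ≤ L k
  k≤L zero    = z≤n
  k≤L (suc k) = ℕ.≤-trans (s≤s (k≤L k)) (growing k)

  limit-≈ : ∀ k → limit ≈[ L k ] s k
  limit-≈ k i i<Lk with ℕ.≤-total k (suc i)
  ... | inj₁ k≤1+i = coherent* (ℕ.≤⇒≤′ k≤1+i) i i<Lk
  ... | inj₂ 1+i≤k = sym (coherent* (ℕ.≤⇒≤′ 1+i≤k) i (k≤L (suc i)))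

module _ {E : ℕ → Family} (E-porous : ∀ j → PrefixPorous (E j)) {A : Cantor} (A-thick : Thick A) where

  stage : ℕ → Stage A
  step  : ∀ j → Extension (E j) (stage j)

  stage zero    = record { length = 0 ; point = A ; point⊆A = λ _ Aᵢ → Aᵢ }
  stage (suc j) = Extension.next (step j)

  step j = extend-into-hole (E-porous j) A-thick (stage j)

  open Fusion (λ k → point (stage k)) (λ k → length (stage k))
              (λ k → Extension.extends (step k)) (λ k → Extension.longer (step k))

  thick⇒subset-outside-prefixPorous : ∃ λ x → x ⊆ω A × ∀ j → ¬ E j x
  thick⇒subset-outside-prefixPorous =
    limit , (λ i → point⊆A (stage (suc i)) i)
          , λ j → Extension.avoids (step j) limit (≈-sym (limit-≈ (suc j)))

mainTheorem7 : (I : Family) → IsIdeal I → SigmaPorous I → ∀ A → I A → ThickPlus A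
mainTheorem7 I I-ideal (E , E-porous , I⊆⋃E) A A∈I A-thick =
  let x , x⊆A , x∉E = thick⇒subset-outside-prefixPorous (λ j → porous⇒prefixPorous (E-porous j)) A-thick
      j , x∈Eⱼ = I⊆⋃E x (IsIdeal.downward I-ideal x A x⊆A A∈I)
  in x∉E j x∈Eⱼ
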